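{- Let $N$ be a project, let $k\ge1$ be an integer with $k\le k_{\max}(N)$, and let $A$ be a minimum-cost $1$-crashing plan of $N$. Then every $k$-crashing plan $X$ of $N$ satisfies $\mathrm{cost}(X)\ge k\cdot \mathrm{cost}(A)$.
   Context: A project is a finite directed acyclic graph $N=(V,E)$ with a unique source $s$ (no incoming edges) and a unique sink $t$ (no outgoing edges). Each edge $e_i\in E$ has attributes $(a_i,b_i,c_i)$: integers $0\le a_i\le b_i$ and a cost rate $c_i\ge 0$. The length of $e_i$ is $b_i$. A path means a directed $s$–$t$ path, its length is the sum of its edge lengths, and the duration $d(N)$ is the maximum path length. A plan $X$ is a multiset of edges of $N$ in which $e_i$ has multiplicity $x_i$ with $0\le x_i\le b_i-a_i$; $\mathrm{cost}(X)=\sum_i c_ix_i$. $N(X)$ is the project obtained from $N$ by replacing each $b_i$ by $b_i-x_i$. A plan $X$ is $k$-crashing for $N$ if $d(N(X))=d(N)-k$. With $E_{b\setminus a}$ the plan giving each $e_i$ multiplicity $b_i-a_i$, $k_{\max}(N)=d(N)-d(N(E_{b\setminus a}))$.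
   Formalization: The cost rates $c_i$ of the edges are nonnegative rationals. -}

module Defs where

open import Data.Nat as ℕ using (ℕ; zero; suc; _∸_)
open import Data.Fin using (Fin; zero; suc)
open import Data.Integer using (+_)
open import Data.Rational as ℚ using (ℚ; 0ℚ; _/_)
open import Data.Product using (Σ; ∃; ∃-syntax; _×_; _,_)
open import Relation.Binary.PropositionalEquality using (_≡_; _≢_)
open import Relation.Nullary using (¬_)

Σℕ : ∀ {m} → (Fin m → ℕ) → ℕ
Σℕ {zero}  f = 0
Σℕ {suc m} f = f zero ℕ.+ Σℕ (λ i → f (suc i))

Σℚ : ∀ {m} → (Fin m → ℚ) → ℚ
Σℚ {zero}  f = 0ℚ
Σℚ {suc m} f = f zero ℚ.+ Σℚ (λ i → f (suc i))

toℚ : ℕ → ℚ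
toℚ k = (+ k) / 1

record Graph : Set where
  field
    n   : ℕ
    m   : ℕ
    src : Fin m → Fin n
    tgt : Fin m → Fin n

module _ (G : Graph) where
  open Graph G

  data Walk : Fin n → Fin n → Set where
    []  : ∀ {u} → Walk u u
    _∷_ : ∀ {v} (i : Fin m) → Walk (tgt i) v → Walk (src i) v

  walkLen : ∀ {u v} → (Fin m → ℕ) → Walk u v → ℕ
  walkLen ℓ []      = 0
  walkLen ℓ (i ∷ w) = ℓ i ℕ.+ walkLen ℓ w

  Acyclic : Set
  Acyclic = ∀ (i : Fin m) → ¬ Walk (tgt i) (src i)

  NoIn : Fin n → Set
  NoIn v = ∀ (i : Fin m) → tgt i ≢ v

  NoOut : Fin n → Set
  NoOut v = ∀ (i : Fin m) → src i ≢ v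

record Project : Set where
  field
    graph    : Graph
  open Graph graph public
  field
    s t      : Fin n
    acyclic  : Acyclic graph
    s-source : NoIn graph s
    s-unique : ∀ v → NoIn graph v → v ≡ s
    t-sink   : NoOut graph t
    t-unique : ∀ v → NoOut graph v → v ≡ t
    a b      : Fin m → ℕ
    c        : Fin m → ℚ
    a≤b      : ∀ i → a i ℕ.≤ b i
    c≥0      : ∀ i → 0ℚ ℚ.≤ c i

module _ (N : Project) where
  open Project N

  -- an s–t path (in a DAG every directed s–t walk is a path)
  Path : Set
  Path = Walk graph s t

  IsDuration : (Fin m → ℕ) → ℕ → Set
  IsDuration ℓ d = (Σ Path λ p → walkLen graph ℓ p ≡ d) × (∀ (p : Path) → walkLen graph ℓ p ℕ.≤ d)

  record Plan : Set where
    field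
      x     : Fin m → ℕ
      x≤b-a : ∀ i → x i ℕ.≤ b i ∸ a i

  cost : Plan → ℚ
  cost X = Σℚ (λ i → c i ℚ.* toℚ (Plan.x X i))

  crashed : Plan → Fin m → ℕ
  crashed X i = b i ∸ Plan.x X i

  Crashing : ℕ → Plan → Set
  Crashing k X = ∃[ d ] ∃[ d' ] IsDuration b d × IsDuration (crashed X) d' × d ≡ d' ℕ.+ k

  -- kmax is k_max(N) = d(N) - d(N(E_{b∖a})), lengths of N(E_{b∖a}) are b i - (b i - a i)
  IsKMax : ℕ → Set
  IsKMax kmax = ∃[ d ] ∃[ d' ] IsDuration b d × IsDuration (λ i → b i ∸ (b i ∸ a i)) d' × d ≡ d' ℕ.+ kmax

  MinCost1Crashing : Plan → Set
  MinCost1Crashing A = Crashing 1 A × (∀ X → Crashing 1 X → cost A ℚ.≤ cost X)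

-- Let T and τ be the longest-path-to-t potentials of N and of N(X), and gap = T ∸ τ, so that
-- gap s = k and gap t = 0.  For j < k, the cut j consists of the edges e = (u , w) with
-- gap w ≤ j < b e + T w ∸ τ u.  On a T-tight edge the upper bound is gap u, so every longest
-- path of N, which is T-tight and runs from gap k down to gap 0, crosses cut j; crashing cut j
-- therefore shortens N, and restoring its edges one at a time gives a 1-crashing plan below it,
-- whose cost is at least cost A.  Since τ u ≥ (b e ∸ x e) + τ w, each edge lies in at most x e
-- of the cuts, whence k · cost A ≤ Σ_{j<k} cost (cut j) ≤ cost X.

{-# OPTIONS --safe #-}
module Submission where

open import Defs
open import Data.Nat using (ℕ; _≤_)
open import Data.Rational using (_*_) renaming (_≤_ to _≤ℚ_)

open import Algebra.Bundles using (CommutativeMonoid)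
import Algebra.Properties.CommutativeSemigroup as CommSemigroupProperties
open import Data.Nat using (zero; suc; _+_; _∸_; _<_; _⊓_; _⊔_; z≤n; s≤s; s≤s⁻¹; _≤?_; _<?_; _≟_)
import Data.Nat.Properties as ℕₚ
open import Data.Nat.Coprimality using (1-coprimeTo) renaming (sym to coprime-sym)
import Data.Integer as ℤ
import Data.Integer.Properties as ℤₚ
open import Data.Rational using (ℚ; mkℚ; 0ℚ; 1ℚ; _/_; *≤*; nonNegative) renaming (_+_ to _+ℚ_)
import Data.Rational.Properties as ℚₚ
open import Data.Fin as Fin using (Fin; zero; suc; toℕ)
import Data.Fin.Properties as Finₚ
open import Data.Empty using (⊥-elim)
open import Data.Product using (Σ; ∃-syntax; _×_; _,_; proj₂)
open import Data.Sum using (_⊎_; inj₁; inj₂)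
open import Function using (_∘_)
open import Relation.Nullary using (Dec; yes; no)
open import Relation.Nullary.Decidable using (_×-dec_)
open import Relation.Binary.PropositionalEquality

open CommSemigroupProperties ℕₚ.+-commutativeSemigroup using (interchange)

-- toℚ n normalises through gcd n 1, which is stuck for a variable n.
toℚ≡mkℚ : ∀ n → toℚ n ≡ mkℚ (ℤ.+ n) 0 (coprime-sym (1-coprimeTo n))
toℚ≡mkℚ n = ℚₚ.↥p/↧p≡p _

toℚ-+ : ∀ m n → toℚ (m + n) ≡ toℚ m +ℚ toℚ n
toℚ-+ m n rewrite toℚ≡mkℚ m | toℚ≡mkℚ n =
  cong₂ (λ i j → (i ℤ.+ j) / 1) (sym (ℤₚ.*-identityʳ (ℤ.+ m))) (sym (ℤₚ.*-identityʳ (ℤ.+ n)))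

toℚ-mono : ∀ {m n} → m ≤ n → toℚ m ≤ℚ toℚ n
toℚ-mono {m} {n} m≤n rewrite toℚ≡mkℚ m | toℚ≡mkℚ n =
  *≤* (subst₂ ℤ._≤_ (sym (ℤₚ.*-identityʳ _)) (sym (ℤₚ.*-identityʳ _)) (ℤ.+≤+ m≤n))

Σℚ-cong : ∀ {m} {f g : Fin m → ℚ} → (∀ i → f i ≡ g i) → Σℚ f ≡ Σℚ g
Σℚ-cong {zero}  f≡g = refl
Σℚ-cong {suc m} f≡g = cong₂ _+ℚ_ (f≡g zero) (Σℚ-cong (f≡g ∘ suc))

Σℚ-+ : ∀ {m} (f g : Fin m → ℚ) → Σℚ (λ i → f i +ℚ g i) ≡ Σℚ f +ℚ Σℚ g
Σℚ-+ {zero}  f g = refl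
Σℚ-+ {suc m} f g =
  trans (cong (f zero +ℚ g zero +ℚ_) (Σℚ-+ (f ∘ suc) (g ∘ suc)))
        (interchangeℚ (f zero) (g zero) (Σℚ (f ∘ suc)) (Σℚ (g ∘ suc)))
  where
  open CommSemigroupProperties (CommutativeMonoid.commutativeSemigroup ℚₚ.+-0-commutativeMonoid)
    using () renaming (interchange to interchangeℚ)

Σℚ-mono : ∀ {m} {f g : Fin m → ℚ} → (∀ i → f i ≤ℚ g i) → Σℚ f ≤ℚ Σℚ g
Σℚ-mono {zero}  f≤g = ℚₚ.≤-refl
Σℚ-mono {suc m} f≤g = ℚₚ.+-mono-≤ (f≤g zero) (Σℚ-mono (f≤g ∘ suc))

Σℚ-zero : ∀ {m} → Σℚ {m} (λ _ → 0ℚ) ≡ 0ℚ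
Σℚ-zero {zero}  = refl
Σℚ-zero {suc m} = cong (0ℚ +ℚ_) (Σℚ-zero {m})

module _ {m} (c : Fin m → ℚ) where

  weighted : (Fin m → ℕ) → ℚ
  weighted x = Σℚ (λ i → c i * toℚ (x i))

  weighted-zero : weighted (λ _ → 0) ≡ 0ℚ
  weighted-zero = trans (Σℚ-cong (λ i → ℚₚ.*-zeroʳ (c i))) (Σℚ-zero {m})

  weighted-+ : ∀ x y → weighted (λ i → x i + y i) ≡ weighted x +ℚ weighted y
  weighted-+ x y =
    trans (Σℚ-cong λ i → trans (cong (c i *_) (toℚ-+ (x i) (y i))) (ℚₚ.*-distribˡ-+ (c i) (toℚ (x i)) (toℚ (y i))))
          (Σℚ-+ (λ i → c i * toℚ (x i)) (λ i → c i * toℚ (y i)))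

  weighted-mono : (∀ i → 0ℚ ≤ℚ c i) → ∀ {x y} → (∀ i → x i ≤ y i) → weighted x ≤ℚ weighted y
  weighted-mono c≥0 x≤y =
    Σℚ-mono λ i → ℚₚ.*-monoˡ-≤-nonNeg (c i) {{nonNegative (c≥0 i)}} (toℚ-mono (x≤y i))

when : ∀ {p} {P : Set p} → Dec P → ℕ → ℕ
when (yes _) x = x
when (no _)  _ = 0

when≤ : ∀ {p} {P : Set p} (P? : Dec P) x → when P? x ≤ x
when≤ (yes _) x = ℕₚ.≤-refl
when≤ (no _)  x = z≤n

when-yes : ∀ {p} {P : Set p} (P? : Dec P) {x} → P → when P? x ≡ x
when-yes (yes _) _  = refl
when-yes (no ¬p) p = ⊥-elim (¬p p)

maxOver : ∀ {k} → (Fin k → ℕ) → ℕ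
maxOver {zero}  f = 0
maxOver {suc k} f = f zero ⊔ maxOver (f ∘ suc)

≤-maxOver : ∀ {k} (f : Fin k → ℕ) i → f i ≤ maxOver f
≤-maxOver f zero    = ℕₚ.m≤m⊔n _ _
≤-maxOver f (suc i) = ℕₚ.≤-trans (≤-maxOver (f ∘ suc) i) (ℕₚ.m≤n⊔m (f zero) _)

maxOver-attained : ∀ {k} (f : Fin k → ℕ) → maxOver f ≡ 0 ⊎ ∃[ i ] maxOver f ≡ f i
maxOver-attained {zero}  f = inj₁ refl
maxOver-attained {suc k} f with ℕₚ.⊔-sel (f zero) (maxOver (f ∘ suc)) | maxOver-attained (f ∘ suc)
... | inj₁ ≡f0 | _              = inj₂ (zero , ≡f0)
... | inj₂ ≡mx | inj₁ mx≡0      = inj₁ (trans ≡mx mx≡0)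
... | inj₂ ≡mx | inj₂ (i , ≡fi) = inj₂ (suc i , trans ≡mx ≡fi)

sumBelow : (ℕ → ℕ) → ℕ → ℕ
sumBelow f zero    = 0
sumBelow f (suc j) = f j + sumBelow f j

inRange : ℕ → ℕ → ℕ → ℕ
inRange lo hi i = when (lo ≤? i ×-dec i <? hi) 1

sumBelow-inRange≤ : ∀ lo hi j → sumBelow (inRange lo hi) j ≤ (j ⊓ hi) ∸ lo
sumBelow-inRange≤ lo hi zero    = z≤n
sumBelow-inRange≤ lo hi (suc j) with lo ≤? j ×-dec j <? hi
... | yes (lo≤j , j<hi) = begin
  suc (sumBelow (inRange lo hi) j) ≤⟨ s≤s (sumBelow-inRange≤ lo hi j) ⟩
  suc ((j ⊓ hi) ∸ lo)               ≡⟨ cong (λ z → suc (z ∸ lo)) (ℕₚ.m≤n⇒m⊓n≡m (ℕₚ.<⇒≤ j<hi)) ⟩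
  suc (j ∸ lo)                      ≡⟨ ℕₚ.+-∸-assoc 1 lo≤j ⟨
  suc j ∸ lo                        ≡⟨ cong (_∸ lo) (ℕₚ.m≤n⇒m⊓n≡m j<hi) ⟨
  (suc j ⊓ hi) ∸ lo                 ∎
  where open ℕₚ.≤-Reasoning
... | no _ =
  ℕₚ.≤-trans (sumBelow-inRange≤ lo hi j) (ℕₚ.∸-monoˡ-≤ lo (ℕₚ.⊓-monoˡ-≤ hi (ℕₚ.n≤1+n j)))

discrete-ivt : ∀ (F : ℕ → ℕ) {c} m → F 0 ≤ c → c ≤ F m → (∀ r → F (suc r) ≤ suc (F r)) →
               ∃[ r ] F r ≡ c
discrete-ivt F zero    F0≤c c≤Fm step = 0 , ℕₚ.≤-antisym F0≤c c≤Fm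
discrete-ivt F (suc m) F0≤c c≤Fm step with _ ≤? F m
... | yes c≤F = discrete-ivt F m F0≤c c≤F step
... | no  c≰F = suc m , ℕₚ.≤-antisym (ℕₚ.≤-trans (step m) (ℕₚ.≰⇒> c≰F)) c≤Fm

atIndex : ℕ → ∀ {m} → Fin m → ℕ
atIndex r e = when (toℕ e ≟ r) 1

module Walks (G : Graph) where
  open Graph G

  infixr 5 _++ᵂ_
  _++ᵂ_ : ∀ {u v w} → Walk G u v → Walk G v w → Walk G u w
  []      ++ᵂ r = r
  (i ∷ q) ++ᵂ r = i ∷ (q ++ᵂ r)

  walkLen-++ : ∀ ℓ {u v w} (q : Walk G u v) (r : Walk G v w) →
               walkLen G ℓ (q ++ᵂ r) ≡ walkLen G ℓ q + walkLen G ℓ r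
  walkLen-++ ℓ []      r = refl
  walkLen-++ ℓ (i ∷ q) r = trans (cong (ℓ i +_) (walkLen-++ ℓ q r)) (sym (ℕₚ.+-assoc (ℓ i) _ _))

  walkLen-mono : ∀ {ℓ ℓ′} → (∀ i → ℓ i ≤ ℓ′ i) → ∀ {u v} (q : Walk G u v) →
                 walkLen G ℓ q ≤ walkLen G ℓ′ q
  walkLen-mono ℓ≤ℓ′ []      = z≤n
  walkLen-mono ℓ≤ℓ′ (i ∷ q) = ℕₚ.+-mono-≤ (ℓ≤ℓ′ i) (walkLen-mono ℓ≤ℓ′ q)

  walkLen-+ : ∀ ℓ ℓ′ {u v} (q : Walk G u v) →
              walkLen G (λ i → ℓ i + ℓ′ i) q ≡ walkLen G ℓ q + walkLen G ℓ′ q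
  walkLen-+ ℓ ℓ′ []      = refl
  walkLen-+ ℓ ℓ′ (i ∷ q) =
    trans (cong (ℓ i + ℓ′ i +_) (walkLen-+ ℓ ℓ′ q)) (interchange (ℓ i) (ℓ′ i) _ _)

  walkLen-∸+ : ∀ {ℓ y} → (∀ i → y i ≤ ℓ i) → ∀ {u v} (q : Walk G u v) →
               walkLen G (λ i → ℓ i ∸ y i) q + walkLen G y q ≡ walkLen G ℓ q
  walkLen-∸+ y≤ℓ []                = refl
  walkLen-∸+ {ℓ} {y} y≤ℓ (i ∷ q) =
    trans (interchange (ℓ i ∸ y i) _ (y i) _) (cong₂ _+_ (ℕₚ.m∸n+n≡m (y≤ℓ i)) (walkLen-∸+ y≤ℓ q))

  walkSize : ∀ {u v} → Walk G u v → ℕ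
  walkSize []      = 0
  walkSize (i ∷ q) = suc (walkSize q)

  vertexAt : ∀ {u v} (q : Walk G u v) → Fin (suc (walkSize q)) → Fin n
  vertexAt {u} q       zero    = u
  vertexAt     (i ∷ q) (suc j) = vertexAt q j

  prefix : ∀ {u v} (q : Walk G u v) j → Walk G u (vertexAt q j)
  prefix q       zero    = []
  prefix (i ∷ q) (suc j) = i ∷ prefix q j

  walkTo-atIndex : ∀ r {u v} (q : Walk G u v) → 0 < walkLen G (atIndex r) q →
                   ∃[ e ] toℕ e ≡ r × Walk G u (src e)
  walkTo-atIndex r (i ∷ q) 0<len with toℕ i ≟ r
  ... | yes i≡r = i , i≡r , []
  ... | no  _   with walkTo-atIndex r q 0<len
  ...   | e , e≡r , q′ = e , e≡r , i ∷ q′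

  longestWithin : (Fin m → ℕ) → ℕ → Fin n → ℕ
  longestWithin ℓ zero    v = 0
  longestWithin ℓ (suc r) v = maxOver (λ i → when (src i Fin.≟ v) (ℓ i + longestWithin ℓ r (tgt i)))

  longestWithin-attained : ∀ ℓ r v → ∃[ u ] Σ (Walk G v u) λ q → walkLen G ℓ q ≡ longestWithin ℓ r v
  longestWithin-attained ℓ zero    v = v , [] , refl
  longestWithin-attained ℓ (suc r) v
    with maxOver-attained (λ i → when (src i Fin.≟ v) (ℓ i + longestWithin ℓ r (tgt i)))
  ... | inj₁ max≡0 = v , [] , sym max≡0
  ... | inj₂ (i , max≡i) with src i Fin.≟ v
  ...   | no  _    = v , [] , sym max≡i
  ...   | yes refl =
    let u , q , len≡ = longestWithin-attained ℓ r (tgt i)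
    in  u , i ∷ q , trans (cong (ℓ i +_) len≡) (sym max≡i)

  walkLen≤longestWithin : ∀ ℓ r {u v} (q : Walk G u v) → walkSize q ≤ r →
                          walkLen G ℓ q ≤ longestWithin ℓ r u
  walkLen≤longestWithin ℓ r       []      _           = z≤n
  walkLen≤longestWithin ℓ (suc r) (i ∷ q) (s≤s size≤r) = begin
    ℓ i + walkLen G ℓ q                                   ≤⟨ ℕₚ.+-monoʳ-≤ (ℓ i) (walkLen≤longestWithin ℓ r q size≤r) ⟩
    ℓ i + longestWithin ℓ r (tgt i)                       ≡⟨ when-yes (src i Fin.≟ src i) refl ⟨
    when (src i Fin.≟ src i) (ℓ i + longestWithin ℓ r (tgt i)) ≤⟨ ≤-maxOver _ i ⟩
    longestWithin ℓ (suc r) (src i)                       ∎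
    where open ℕₚ.≤-Reasoning

module AcyclicWalks (G : Graph) (acyclic : Acyclic G) where
  open Graph G
  open Walks G

  vertexAt-<⇒≢ : ∀ {u v} (q : Walk G u v) {i j} → i Fin.< j → vertexAt q i ≢ vertexAt q j
  vertexAt-<⇒≢ (e ∷ q) {zero}  {suc j} _         eq = acyclic e (subst (Walk G (tgt e)) (sym eq) (prefix q j))
  vertexAt-<⇒≢ (e ∷ q) {suc i} {suc j} (s≤s i<j) eq = vertexAt-<⇒≢ q i<j eq

  walkSize<n : ∀ {u v} (q : Walk G u v) → walkSize q < n
  walkSize<n q with walkSize q <? n
  ... | yes size<n = size<n
  ... | no  size≮n =
    let i , j , i<j , eq = Finₚ.pigeonhole (s≤s (ℕₚ.≮⇒≥ size≮n)) (vertexAt q)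
    in  ⊥-elim (vertexAt-<⇒≢ q i<j eq)

  walkLen-atIndex≤1 : ∀ r {u v} (q : Walk G u v) → walkLen G (atIndex r) q ≤ 1
  walkLen-atIndex≤1 r []      = z≤n
  walkLen-atIndex≤1 r (i ∷ q) with toℕ i ≟ r
  ... | no  _   = walkLen-atIndex≤1 r q
  ... | yes i≡r with 0 <? walkLen G (atIndex r) q
  ...   | no  0≮len = s≤s (ℕₚ.≮⇒≥ 0≮len)
  ...   | yes 0<len with walkTo-atIndex r q 0<len
  ...     | e , e≡r , q′ with Finₚ.toℕ-injective (trans e≡r (sym i≡r))
  ...       | refl = ⊥-elim (acyclic e q′)

  longest : (Fin m → ℕ) → Fin n → ℕ
  longest ℓ = longestWithin ℓ n

  longest-attained : ∀ ℓ v → ∃[ u ] Σ (Walk G v u) λ q → walkLen G ℓ q ≡ longest ℓ v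
  longest-attained ℓ = longestWithin-attained ℓ n

  walkLen≤longest : ∀ ℓ {u v} (q : Walk G u v) → walkLen G ℓ q ≤ longest ℓ u
  walkLen≤longest ℓ q = walkLen≤longestWithin ℓ n q (ℕₚ.<⇒≤ (walkSize<n q))

  longest-edge : ∀ ℓ i → ℓ i + longest ℓ (tgt i) ≤ longest ℓ (src i)
  longest-edge ℓ i =
    let _ , q , len≡ = longest-attained ℓ (tgt i)
    in  subst (λ z → ℓ i + z ≤ longest ℓ (src i)) len≡ (walkLen≤longest ℓ (i ∷ q))

  longest-mono : ∀ {ℓ ℓ′} → (∀ i → ℓ i ≤ ℓ′ i) → ∀ v → longest ℓ v ≤ longest ℓ′ v
  longest-mono {ℓ} {ℓ′} ℓ≤ℓ′ v =
    let _ , q , len≡ = longest-attained ℓ v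
    in  subst (_≤ longest ℓ′ v) len≡ (ℕₚ.≤-trans (walkLen-mono ℓ≤ℓ′ q) (walkLen≤longest ℓ′ q))

module Projects (N : Project) where
  open Project N
  open Walks graph
  open AcyclicWalks graph acyclic

  outgoing : ∀ v → v ≢ t → ∃[ i ] src i ≡ v
  outgoing v v≢t with Finₚ.any? (λ i → src i Fin.≟ v)
  ... | yes found = found
  ... | no  none  = ⊥-elim (v≢t (t-unique v λ i srci≡v → none (i , srci≡v)))

  walkToSink-or-long : ∀ fuel v → Walk graph v t ⊎ ∃[ u ] Σ (Walk graph v u) λ q → fuel ≤ walkSize q
  walkToSink-or-long zero    v = inj₂ (v , [] , z≤n)
  walkToSink-or-long (suc f) v with v Fin.≟ t
  ... | yes refl = inj₁ []
  ... | no  v≢t  with outgoing v v≢t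
  ...   | i , refl with walkToSink-or-long f (tgt i)
  ...     | inj₁ q               = inj₁ (i ∷ q)
  ...     | inj₂ (u , q , f≤size) = inj₂ (u , i ∷ q , s≤s f≤size)

  walkToSink : ∀ v → Walk graph v t
  walkToSink v with walkToSink-or-long n v
  ... | inj₁ q                = q
  ... | inj₂ (_ , q , n≤size) = ⊥-elim (ℕₚ.<⇒≱ (walkSize<n q) n≤size)

  walkLen-fromSink : ∀ ℓ {w u} (q : Walk graph w u) → w ≡ t → walkLen graph ℓ q ≡ 0
  walkLen-fromSink ℓ []      _      = refl
  walkLen-fromSink ℓ (i ∷ q) srci≡t = ⊥-elim (t-sink i srci≡t)

  longest-sink : ∀ ℓ → longest ℓ t ≡ 0
  longest-sink ℓ = let _ , q , len≡ = longest-attained ℓ t in trans (sym len≡) (walkLen-fromSink ℓ q refl)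

  longest-isDuration : ∀ ℓ → IsDuration N ℓ (longest ℓ s)
  longest-isDuration ℓ with longest-attained ℓ s
  ... | u , q , len≡ =
    (q ++ᵂ walkToSink u , ℕₚ.≤-antisym (walkLen≤longest ℓ (q ++ᵂ walkToSink u)) longest≤) , walkLen≤longest ℓ
    where
    open ℕₚ.≤-Reasoning
    longest≤ : longest ℓ s ≤ walkLen graph ℓ (q ++ᵂ walkToSink u)
    longest≤ = begin
      longest ℓ s                                         ≡⟨ len≡ ⟨
      walkLen graph ℓ q                                   ≤⟨ ℕₚ.m≤m+n _ _ ⟩
      walkLen graph ℓ q + walkLen graph ℓ (walkToSink u)  ≡⟨ walkLen-++ ℓ q (walkToSink u) ⟨
      walkLen graph ℓ (q ++ᵂ walkToSink u)                ∎

  isDuration⇒≡longest : ∀ {ℓ d} → IsDuration N ℓ d → d ≡ longest ℓ s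
  isDuration⇒≡longest {ℓ} {d} ((p , len≡d) , ≤d) with longest-isDuration ℓ
  ... | (q , len≡longest) , _ = ℕₚ.≤-antisym (subst (_≤ longest ℓ s) len≡d (walkLen≤longest ℓ p))
                                             (subst (_≤ d) len≡longest (≤d q))

  -- Restore the edges of y one index at a time: a path uses each edge at most once, so every step
  -- lengthens N by at most 1, and some intermediate plan shortens N by exactly 1.
  crashing1-below : ∀ {d} → IsDuration N b d →
                    (y : Fin m → ℕ) → (∀ e → y e ≤ 1) → (∀ e → y e ≤ b e ∸ a e) →
                    (∀ (p : Path N) → walkLen graph (λ e → b e ∸ y e) p < d) →
                    Σ (Plan N) λ Y → Crashing N 1 Y × (∀ e → Plan.x Y e ≤ y e)
  crashing1-below {zero}  ((p , _) , _) y _ _ shorter = ⊥-elim (ℕₚ.n≮0 (shorter p))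
  crashing1-below {suc d} isDur y y≤1 y≤b∸a shorter = exactly-one-shorter (discrete-ivt F m F0≤d d≤Fm F-step)
    where
    kept : ℕ → Fin m → ℕ
    kept r e = when (r ≤? toℕ e) (y e)

    restored : ℕ → Plan N
    restored r = record { x = kept r ; x≤b-a = λ e → ℕₚ.≤-trans (when≤ _ (y e)) (y≤b∸a e) }

    F : ℕ → ℕ
    F r = longest (crashed N (restored r)) s

    F0≤d : F 0 ≤ d
    F0≤d with longest-isDuration (crashed N (restored 0))
    ... | (p , len≡) , _ = subst (_≤ d) len≡ (s≤s⁻¹ (shorter p))

    d≤Fm : d ≤ F m
    d≤Fm = begin
      d            ≤⟨ ℕₚ.n≤1+n d ⟩
      suc d        ≡⟨ isDuration⇒≡longest isDur ⟩
      longest b s  ≤⟨ longest-mono (λ e → ℕₚ.≤-reflexive (cong (b e ∸_) (sym (nothing-kept e)))) s ⟩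
      F m          ∎
      where
      open ℕₚ.≤-Reasoning
      nothing-kept : ∀ e → kept m e ≡ 0
      nothing-kept e with m ≤? toℕ e
      ... | yes m≤e = ⊥-elim (ℕₚ.<⇒≱ (Finₚ.toℕ<n e) m≤e)
      ... | no  _   = refl

    kept-step : ∀ r e → toℕ e ≢ r → kept r e ≤ kept (suc r) e
    kept-step r e e≢r with r ≤? toℕ e | suc r ≤? toℕ e
    ... | no  _   | _         = z≤n
    ... | yes _   | yes _     = ℕₚ.≤-refl
    ... | yes r≤e | no  r≮e   = ⊥-elim (r≮e (ℕₚ.≤∧≢⇒< r≤e (e≢r ∘ sym)))

    restore-step : ∀ r e → b e ∸ kept (suc r) e ≤ atIndex r e + (b e ∸ kept r e)
    restore-step r e with toℕ e ≟ r
    ... | no  e≢r = ℕₚ.∸-monoʳ-≤ (b e) (kept-step r e e≢r)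
    ... | yes _   = begin
      b e ∸ kept (suc r) e  ≤⟨ ℕₚ.m∸n≤m (b e) (kept (suc r) e) ⟩
      b e                   ≤⟨ ℕₚ.m≤n+m∸n (b e) (y e) ⟩
      y e + (b e ∸ y e)     ≤⟨ ℕₚ.+-mono-≤ (y≤1 e) (ℕₚ.∸-monoʳ-≤ (b e) (when≤ (r ≤? toℕ e) (y e))) ⟩
      1 + (b e ∸ kept r e)  ∎
      where open ℕₚ.≤-Reasoning

    F-step : ∀ r → F (suc r) ≤ suc (F r)
    F-step r with longest-isDuration (crashed N (restored (suc r)))
    ... | (p , len≡) , _ = begin
      F (suc r)                                                  ≡⟨ len≡ ⟨
      walkLen graph (crashed N (restored (suc r))) p             ≤⟨ walkLen-mono (restore-step r) p ⟩
      walkLen graph (λ e → atIndex r e + (b e ∸ kept r e)) p     ≡⟨ walkLen-+ (atIndex r) (crashed N (restored r)) p ⟩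
      walkLen graph (atIndex r) p + walkLen graph (crashed N (restored r)) p
                                                                 ≤⟨ ℕₚ.+-mono-≤ (walkLen-atIndex≤1 r p) (walkLen≤longest _ p) ⟩
      suc (F r)                                                  ∎
      where open ℕₚ.≤-Reasoning

    exactly-one-shorter : ∃[ r ] F r ≡ d → Σ (Plan N) λ Y → Crashing N 1 Y × (∀ e → Plan.x Y e ≤ y e)
    exactly-one-shorter (r , Fr≡d) =
      restored r , (suc d , F r , isDur , longest-isDuration _ , trans (cong suc (sym Fr≡d)) (ℕₚ.+-comm 1 (F r))) ,
      λ e → when≤ _ (y e)

  module Cuts (X : Plan N) {k d d′} (isDur : IsDuration N b d) (isDur′ : IsDuration N (crashed N X) d′)
              (d≡d′+k : d ≡ d′ + k) where
    open Plan X using (x; x≤b-a)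

    T τ gap : Fin n → ℕ
    T = longest b
    τ = longest (crashed N X)
    gap v = T v ∸ τ v

    edgeGap : Fin m → ℕ
    edgeGap e = (b e + T (tgt e)) ∸ τ (src e)

    cut : ℕ → Fin m → ℕ
    cut j e = inRange (gap (tgt e)) (edgeGap e) j

    cutsBelow : ℕ → Fin m → ℕ
    cutsBelow j e = sumBelow (λ i → cut i e) j

    edgeGap≤x+gap : ∀ e → edgeGap e ≤ x e + gap (tgt e)
    edgeGap≤x+gap e = begin
      (b e + T w) ∸ τ u                                     ≤⟨ ℕₚ.∸-monoˡ-≤ (τ u) (begin
        b e + T w                                           ≡⟨ cong (b e +_) (ℕₚ.m∸n+n≡m τ≤T) ⟨
        b e + (gap w + τ w)                                 ≤⟨ ℕₚ.+-monoˡ-≤ _ (ℕₚ.m≤n+m∸n (b e) (x e)) ⟩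
        (x e + (b e ∸ x e)) + (gap w + τ w)                 ≡⟨ interchange (x e) _ (gap w) _ ⟩
        (x e + gap w) + ((b e ∸ x e) + τ w)                 ≤⟨ ℕₚ.+-monoʳ-≤ _ (longest-edge (crashed N X) e) ⟩
        (x e + gap w) + τ u                                 ∎) ⟩
      ((x e + gap w) + τ u) ∸ τ u                           ≡⟨ ℕₚ.m+n∸n≡m _ (τ u) ⟩
      x e + gap w                                           ∎
      where
      open ℕₚ.≤-Reasoning
      u = src e
      w = tgt e
      τ≤T : τ w ≤ T w
      τ≤T = longest-mono (λ i → ℕₚ.m∸n≤m (b i) (x i)) w

    cutsBelow≤x : ∀ j e → cutsBelow j e ≤ x e
    cutsBelow≤x j e = begin
      cutsBelow j e                         ≤⟨ sumBelow-inRange≤ (gap (tgt e)) (edgeGap e) j ⟩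
      (j ⊓ edgeGap e) ∸ gap (tgt e)         ≤⟨ ℕₚ.∸-monoˡ-≤ (gap (tgt e))
                                                 (ℕₚ.≤-trans (ℕₚ.m⊓n≤n j _) (edgeGap≤x+gap e)) ⟩
      (x e + gap (tgt e)) ∸ gap (tgt e)     ≡⟨ ℕₚ.m+n∸n≡m (x e) (gap (tgt e)) ⟩
      x e                                   ∎
      where open ℕₚ.≤-Reasoning

    cut≤x : ∀ j e → cut j e ≤ x e
    cut≤x j e = ℕₚ.≤-trans (ℕₚ.m≤m+n (cut j e) (cutsBelow j e)) (cutsBelow≤x (suc j) e)

    cut≤b∸a : ∀ j e → cut j e ≤ b e ∸ a e
    cut≤b∸a j e = ℕₚ.≤-trans (cut≤x j e) (x≤b-a e)

    cut-on-tight-walk : ∀ j {u v} (q : Walk graph u v) → T u ≤ walkLen graph b q → gap v ≤ j → j < gap u →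
                        0 < walkLen graph (cut j) q
    cut-on-tight-walk j []      _     gapv≤j j<gapu = ⊥-elim (ℕₚ.<⇒≱ j<gapu gapv≤j)
    cut-on-tight-walk j (e ∷ q) tight gapv≤j j<gapu with ℕₚ.≤-<-connex (gap (tgt e)) j
    ... | inj₁ gapw≤j = ℕₚ.≤-trans (ℕₚ.≤-reflexive (sym cut≡1)) (ℕₚ.m≤m+n _ _)
      where
      e-tight : T (src e) ≡ b e + T (tgt e)
      e-tight = ℕₚ.≤-antisym (ℕₚ.≤-trans tight (ℕₚ.+-monoʳ-≤ (b e) (walkLen≤longest b q))) (longest-edge b e)
      cut≡1 : cut j e ≡ 1
      cut≡1 = when-yes (gap (tgt e) ≤? j ×-dec j <? edgeGap e)
                       (gapw≤j , subst (j <_) (cong (_∸ τ (src e)) e-tight) j<gapu)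
    ... | inj₂ j<gapw = ℕₚ.≤-trans (cut-on-tight-walk j q q-tight gapv≤j j<gapw) (ℕₚ.m≤n+m _ (cut j e))
      where
      q-tight : T (tgt e) ≤ walkLen graph b q
      q-tight = ℕₚ.+-cancelˡ-≤ (b e) _ _ (ℕₚ.≤-trans (longest-edge b e) tight)

    T-source : T s ≡ d
    T-source = sym (isDuration⇒≡longest isDur)

    gap-source : gap s ≡ k
    gap-source =
      trans (cong₂ _∸_ (trans T-source d≡d′+k) (sym (isDuration⇒≡longest isDur′))) (ℕₚ.m+n∸m≡n d′ k)

    gap-sink : gap t ≡ 0
    gap-sink = trans (cong (_∸ τ t) (longest-sink b)) (ℕₚ.0∸n≡0 (τ t))

    cut-shortens : ∀ j → j < k → ∀ (p : Path N) → walkLen graph (λ e → b e ∸ cut j e) p < d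
    cut-shortens j j<k p with ℕₚ.m≤n⇒m<n∨m≡n (proj₂ isDur p)
    ... | inj₁ len<d = ℕₚ.≤-<-trans (walkLen-mono (λ e → ℕₚ.m∸n≤m (b e) (cut j e)) p) len<d
    ... | inj₂ len≡d = begin-strict
      walkLen graph (λ e → b e ∸ cut j e) p                               <⟨ ℕₚ.m<m+n _ crosses ⟩
      walkLen graph (λ e → b e ∸ cut j e) p + walkLen graph (cut j) p     ≡⟨ walkLen-∸+ cut≤b p ⟩
      walkLen graph b p                                                   ≡⟨ len≡d ⟩
      d                                                                   ∎
      where
      open ℕₚ.≤-Reasoning
      cut≤b : ∀ e → cut j e ≤ b e
      cut≤b e = ℕₚ.≤-trans (cut≤b∸a j e) (ℕₚ.m∸n≤m (b e) (a e))
      crosses : 0 < walkLen graph (cut j) p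
      crosses = cut-on-tight-walk j p (ℕₚ.≤-reflexive (trans T-source (sym len≡d)))
                  (subst (_≤ j) (sym gap-sink) z≤n) (subst (j <_) (sym gap-source) j<k)

    cost≤cut : (A : Plan N) → MinCost1Crashing N A → ∀ j → j < k → cost N A ≤ℚ weighted c (cut j)
    cost≤cut A (_ , A-min) j j<k
      with crashing1-below isDur (cut j) (λ e → when≤ _ 1) (cut≤b∸a j) (cut-shortens j j<k)
    ... | Y , Y-crashing , Y≤cut = ℚₚ.≤-trans (A-min Y Y-crashing) (weighted-mono c c≥0 Y≤cut)

    scaled-cost≤cutsBelow : (A : Plan N) → MinCost1Crashing N A → ∀ j → j ≤ k →
                            toℚ j * cost N A ≤ℚ weighted c (cutsBelow j)
    scaled-cost≤cutsBelow A A-min zero    _    =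
      ℚₚ.≤-reflexive (trans (ℚₚ.*-zeroˡ (cost N A)) (sym (weighted-zero c)))
    scaled-cost≤cutsBelow A A-min (suc j) j<k = begin
      toℚ (suc j) * cost N A                          ≡⟨ cong (_* cost N A) (toℚ-+ 1 j) ⟩
      (1ℚ +ℚ toℚ j) * cost N A                        ≡⟨ ℚₚ.*-distribʳ-+ (cost N A) 1ℚ (toℚ j) ⟩
      1ℚ * cost N A +ℚ toℚ j * cost N A               ≡⟨ cong (_+ℚ toℚ j * cost N A) (ℚₚ.*-identityˡ (cost N A)) ⟩
      cost N A +ℚ toℚ j * cost N A                    ≤⟨ ℚₚ.+-mono-≤ (cost≤cut A A-min j j<k)
                                                           (scaled-cost≤cutsBelow A A-min j (ℕₚ.<⇒≤ j<k)) ⟩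
      weighted c (cut j) +ℚ weighted c (cutsBelow j)  ≡⟨ weighted-+ c (cut j) (cutsBelow j) ⟨
      weighted c (cutsBelow (suc j))                  ∎
      where open ℚₚ.≤-Reasoning

-- The bound holds for every k-crashing plan.
lemma2p2 : (N : Project) (kmax k : ℕ) → IsKMax N kmax → 1 ≤ k → k ≤ kmax →
    (A : Plan N) → MinCost1Crashing N A →
    (X : Plan N) → Crashing N k X → toℚ k * cost N A ≤ℚ cost N X
lemma2p2 N _ k _ _ _ A A-min X (_ , _ , isDur , isDur′ , d≡d′+k) =
  ℚₚ.≤-trans (scaled-cost≤cutsBelow A A-min k ℕₚ.≤-refl) (weighted-mono c c≥0 (cutsBelow≤x k))
  where
  open Project N using (c; c≥0)
  open Projects.Cuts N X isDur isDur′ d≡d′+k
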